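{- Any insertion sequence with no repeated insertion sites using $k$ monomer types forming $m$ insertion sets has length $O(m\sqrt{k})$.
   Context: An insertion system has symbols each with a complement ($\overline s=s^*$, $\overline{s^*}=s$), monomer types $(a,b,c,d)^+$ or $(a,b,c,d)^-$ with concentrations, and an initiator $(a,b)(c,d)$ with $\overline a=d$ or $\overline b=c$. In a polymer, each pair of adjacent monomer ends $(a,b)(c,d)$ is an insertion site. Into a site $(a,b)(c,d)$: if $\overline a=d$, any $(\overline b,e,f,\overline c)^+$ can be inserted, producing sites $(a,b)(\overline b,e)$ and $(f,\overline c)(c,d)$; if $\overline b=c$, any $(e,\overline a,\overline d,f)^-$ can be inserted, producing sites $(a,b)(e,\overline a)$ and $(\overline d,f)(c,d)$. An insertion sequence is a sequence of monomer insertions in which each insertion is into a site created by the previous insertion; its length is the number of insertions. An insertion set is a maximal set of same-signed monomer types sharing a common set of insertion sites into which each can be inserted; equivalently, positive types are grouped by their (first, fourth) symbols and negative types by their (second, third) symbols. Here $k$ is the number of distinct monomer types inserted in the sequence and $m$ the number of insertion sets these types form. -}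

module Defs where

open import Data.Nat using (ℕ; _^_; _*_; _≤_)
open import Data.Bool using (Bool; true; false; not)
open import Data.Product using (_×_; _,_; proj₁; proj₂; ∃-syntax)
open import Data.Sum using (_⊎_)
open import Data.Unit using (⊤)
open import Data.List using (List; []; _∷_; [_]; _++_; map; length; deduplicate)
open import Data.List.Membership.Propositional using (_∈_)
open import Relation.Binary.PropositionalEquality using (_≡_)
open import Relation.Binary.Construct.Closure.ReflexiveTransitive using (Star)
open import Relation.Binary.Definitions using (DecidableEquality)
import Data.Product.Properties as PP
import Data.Nat.Properties as NP
import Data.Bool.Properties as BP
open import Relation.Nullary using (yes; no)

-- A symbol: a base name with a flag; (n , false) is s, (n , true) is s*.
Sym : Set
Sym = ℕ × Bool

‾_ : Sym → Sym
‾ (n , b) = (n , not b)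

_≟S_ : DecidableEquality Sym
_≟S_ = PP.≡-dec NP._≟_ BP._≟_

data Sign : Set where
  plus minus : Sign

_≟Sign_ : DecidableEquality Sign
plus ≟Sign plus = yes _≡_.refl
plus ≟Sign minus = no (λ ())
minus ≟Sign plus = no (λ ())
minus ≟Sign minus = yes _≡_.refl

Monomer : Set
Monomer = Sign × Sym × Sym × Sym × Sym

_≟M_ : DecidableEquality Monomer
_≟M_ = PP.≡-dec _≟Sign_ (PP.≡-dec _≟S_ (PP.≡-dec _≟S_ (PP.≡-dec _≟S_ _≟S_)))

End : Set
End = Sym × Sym

Site : Set
Site = End × End

data CanInsert : Site → Monomer → Set where
  ins⁺ : ∀ {a b c d e f} → ‾ a ≡ d →
         CanInsert ((a , b) , (c , d)) (plus , ‾ b , e , f , ‾ c)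
  ins⁻ : ∀ {a b c d e f} → ‾ b ≡ c →
         CanInsert ((a , b) , (c , d)) (minus , e , ‾ a , ‾ d , f)

leftSite : Site → Monomer → Site
leftSite (L , R) (_ , x , y , z , w) = (L , (x , y))

rightSite : Site → Monomer → Site
rightSite (L , R) (_ , x , y , z , w) = ((z , w) , R)

-- An insertion system (concentrations play no role for insertion sequences).
record InsertionSystem : Set where
  field
    types     : List Monomer
    initiator : Site
    initOK    : (‾ proj₁ (proj₁ initiator) ≡ proj₂ (proj₂ initiator))
              ⊎ (‾ proj₂ (proj₁ initiator) ≡ proj₁ (proj₂ initiator))

-- A polymer is represented by the list of its insertion sites (left to right).
Polymer : Set
Polymer = List Site

data Step (T : List Monomer) : Polymer → Polymer → Set where
  step : ∀ xs ys s t → t ∈ T → CanInsert s t →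
         Step T (xs ++ s ∷ ys) (xs ++ leftSite s t ∷ rightSite s t ∷ ys)

Reachable : InsertionSystem → Polymer → Set
Reachable S P = Star (Step (InsertionSystem.types S)) [ InsertionSystem.initiator S ] P

data Chain (T : List Monomer) : List (Site × Monomer) → Set where
  []  : Chain T []
  single : ∀ {s t} → t ∈ T → CanInsert s t → Chain T [ (s , t) ]
  cons : ∀ {s t s' t' rest} → t ∈ T → CanInsert s t →
         (s' ≡ leftSite s t ⊎ s' ≡ rightSite s t) →
         Chain T ((s' , t') ∷ rest) → Chain T ((s , t) ∷ (s' , t') ∷ rest)

StartsInPolymer : InsertionSystem → List (Site × Monomer) → Set
StartsInPolymer S [] = ⊤
StartsInPolymer S ((s , t) ∷ _) = ∃[ P ] (Reachable S P × s ∈ P)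

InsertionSequence : InsertionSystem → List (Site × Monomer) → Set
InsertionSequence S xs = Chain (InsertionSystem.types S) xs × StartsInPolymer S xs

insertionSetKey : Monomer → Sign × Sym × Sym
insertionSetKey (plus , a , b , c , d) = (plus , a , d)
insertionSetKey (minus , a , b , c , d) = (minus , b , c)

_≟K_ : DecidableEquality (Sign × Sym × Sym)
_≟K_ = PP.≡-dec _≟Sign_ (PP.≡-dec _≟S_ _≟S_)

numTypes : List (Site × Monomer) → ℕ
numTypes xs = length (deduplicate _≟M_ (map proj₂ xs))

numSets : List (Site × Monomer) → ℕ
numSets xs = length (deduplicate _≟K_ (map (λ p → insertionSetKey (proj₂ p)) xs))

module Submission where

-- A transition is a pair of consecutive insertions of opposite signs; let d be
-- their number.
-- (1) Three consecutive insertions of one sign force a repeated site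
--     (same-sign-triple), so the sign changes at least every second step and
--     n ≤ 2d + 2 (changes-length).
-- (2) The second site of a transition was created inside the first, so the two
--     sites share an end on one side; that side and end form the class of the
--     transition. Every end along the sequence is an end of the first site or
--     an end brought in by a monomer type (chain-ends), so at most 2 + 2k
--     classes occur, and Cauchy–Schwarz gives d² ≤ (2 + 2k) P, where P counts
--     ordered pairs of transitions in a common class.
-- (3) For such a pair (τ , τ′), the positive entry of τ and the negative entry
--     of τ′ sit in sites sharing the class end, and such sites are fixed by the
--     side and the two insertion-set keys (pinned). Sites being distinct, the
--     pair is recovered from side, keys and orientations: P ≤ 8 m².

open import Defs
open import Data.Nat using (ℕ; zero; suc; _+_; _*_; _∸_; _^_; _≤_; z≤n; s≤s)
open import Data.Nat.Properties
  using ( ≤-refl; ≤-reflexive; ≤-trans; ≤-total; n≤1+n; m≤n⇒m≤1+n; m≤m+n; m+[n∸m]≡n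
        ; +-comm; +-assoc; +-suc; +-identityʳ; *-identityˡ; *-identityʳ; *-assoc
        ; +-mono-≤; +-monoˡ-≤; +-monoʳ-≤; *-mono-≤; *-monoʳ-≤; *-cancelˡ-≤; module ≤-Reasoning)
open import Data.Nat.ListAction using (sum)
open import Data.Nat.Tactic.RingSolver using (solve-∀)
open import Data.Bool.Properties using (not-involutive)
open import Data.Product using (_×_; _,_; proj₁; proj₂; ∃-syntax)
open import Data.Product.Properties using (≡-dec)
open import Data.Sum using (_⊎_; inj₁; inj₂)
open import Data.Unit using (⊤)
open import Data.Empty using (⊥-elim)
open import Data.List
  using (List; []; _∷_; _++_; map; length; filter; deduplicate; cartesianProduct; cartesianProductWith)
open import Data.List.Properties using (length-map; length-++; length-++-sucʳ; filter-++)
open import Data.List.Membership.Propositional using (_∈_)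
open import Data.List.Membership.Propositional.Properties
  using ( ∈-map⁺; ∈-map⁻; ∈-∃++; ∈-++⁻; ∈-++⁺ˡ; ∈-++⁺ʳ; ∈-filter⁻; ∈-deduplicate⁺
        ; ∈-cartesianProduct⁺; ∈-cartesianProduct⁻; ∈-cartesianProductWith⁺)
open import Data.List.Relation.Unary.Any using (here; there)
open import Data.List.Relation.Unary.All as All using (_∷_)
open import Data.List.Relation.Unary.All.Properties using () renaming (map⁺ to All-map⁺)
open import Data.List.Relation.Unary.AllPairs using ([]; _∷_)
open import Data.List.Relation.Unary.Unique.Propositional using (Unique)
import Data.List.Relation.Unary.Unique.Propositional.Properties as Unique
open import Relation.Binary.Definitions using (DecidableEquality)
open import Relation.Binary.PropositionalEquality
open import Relation.Nullary using (¬_; Dec; yes; no; ¬?)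

unique-⊆-length : ∀ {X : Set} {xs ys : List X} → Unique xs →
                  (∀ {x} → x ∈ xs → x ∈ ys) → length xs ≤ length ys
unique-⊆-length {xs = []} _ _ = z≤n
unique-⊆-length {xs = x ∷ xs} (x∉xs ∷ u) xs⊆ys with ∈-∃++ (xs⊆ys (here refl))
... | as , bs , refl =
  ≤-trans (s≤s (unique-⊆-length u xs⊆as++bs)) (≤-reflexive (sym (length-++-sucʳ as x bs)))
  where
  xs⊆as++bs : ∀ {y} → y ∈ xs → y ∈ as ++ bs
  xs⊆as++bs {y} y∈xs with ∈-++⁻ as (xs⊆ys (there y∈xs))
  ... | inj₁ y∈as         = ∈-++⁺ˡ y∈as
  ... | inj₂ (here refl)  = ⊥-elim (All.lookup x∉xs y∈xs refl)
  ... | inj₂ (there y∈bs) = ∈-++⁺ʳ as y∈bs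

injection-length : ∀ {X Y : Set} {xs : List X} {ys : List Y} (g : X → Y) → Unique xs →
                   (∀ {a b} → a ∈ xs → b ∈ xs → g a ≡ g b → a ≡ b) →
                   (∀ {a} → a ∈ xs → g a ∈ ys) → length xs ≤ length ys
injection-length {xs = xs} {ys} g u g-inj g-into =
  subst (_≤ length ys) (length-map g xs) (unique-⊆-length (map-unique u g-inj) map⊆ys)
  where
  map-unique : ∀ {zs} → Unique zs → (∀ {a b} → a ∈ zs → b ∈ zs → g a ≡ g b → a ≡ b) →
               Unique (map g zs)
  map-unique [] _ = []
  map-unique (z∉zs ∷ u) inj =
    All-map⁺ (All.tabulate λ b∈zs e → All.lookup z∉zs b∈zs (inj (here refl) (there b∈zs) e))
    ∷ map-unique u (λ a∈ b∈ → inj (there a∈) (there b∈))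
  map⊆ys : ∀ {y} → y ∈ map g xs → y ∈ ys
  map⊆ys y∈ with ∈-map⁻ g y∈
  ... | a , a∈xs , refl = g-into a∈xs

length-cartesianProductWith : ∀ {X Y Z : Set} (f : X → Y → Z) (xs : List X) (ys : List Y) →
  length (cartesianProductWith f xs ys) ≡ length xs * length ys
length-cartesianProductWith f [] ys = refl
length-cartesianProductWith f (x ∷ xs) ys = begin
  length (map (f x) ys ++ cartesianProductWith f xs ys)   ≡⟨ length-++ (map (f x) ys) ⟩
  length (map (f x) ys) + length (cartesianProductWith f xs ys)
    ≡⟨ cong₂ _+_ (length-map (f x) ys) (length-cartesianProductWith f xs ys) ⟩
  length ys + length xs * length ys                         ∎
  where open ≡-Reasoning

length-cartesianProduct : ∀ {X Y : Set} (xs : List X) (ys : List Y) →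
  length (cartesianProduct xs ys) ≡ length xs * length ys
length-cartesianProduct = length-cartesianProductWith _,_

data Adjacent {X : Set} (x y : X) : List X → Set where
  here  : ∀ {r} → Adjacent x y (x ∷ y ∷ r)
  there : ∀ {z r} → Adjacent x y r → Adjacent x y (z ∷ r)

adjacent-∈ˡ : ∀ {X : Set} {x y : X} {l} → Adjacent x y l → x ∈ l
adjacent-∈ˡ here      = here refl
adjacent-∈ˡ (there a) = there (adjacent-∈ˡ a)

adjacent-∈ʳ : ∀ {X : Set} {x y z : X} {l} → Adjacent x y (z ∷ l) → y ∈ l
adjacent-∈ʳ here                  = here refl
adjacent-∈ʳ {l = []}    (there ())
adjacent-∈ʳ {l = _ ∷ _} (there a) = there (adjacent-∈ʳ a)

module AdjacentUnique {X Y : Set} (g : X → Y) where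

  private
    not-later : ∀ {z r w} → Unique (map g (z ∷ r)) → w ∈ r → g z ≢ g w
    not-later (z∉r ∷ _) w∈r = All.lookup z∉r (∈-map⁺ g w∈r)

  adjacent-first : ∀ {l x y x′ y′} → Unique (map g l) → Adjacent x y l → Adjacent x′ y′ l →
                   g x ≡ g x′ → x ≡ x′ × y ≡ y′
  adjacent-first u here      here       e = refl , refl
  adjacent-first u here      (there a′) e = ⊥-elim (not-later u (adjacent-∈ˡ a′) e)
  adjacent-first u (there a) here       e = ⊥-elim (not-later u (adjacent-∈ˡ a) (sym e))
  adjacent-first (_ ∷ u) (there a) (there a′) e = adjacent-first u a a′ e

  adjacent-second : ∀ {l x y x′ y′} → Unique (map g l) → Adjacent x y l → Adjacent x′ y′ l →
                    g y ≡ g y′ → x ≡ x′ × y ≡ y′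
  adjacent-second u here      here       e = refl , refl
  adjacent-second (_ ∷ u) here (there a′) e = ⊥-elim (not-later u (adjacent-∈ʳ a′) e)
  adjacent-second (_ ∷ u) (there a) here  e = ⊥-elim (not-later u (adjacent-∈ʳ a) (sym e))
  adjacent-second (_ ∷ u) (there a) (there a′) e = adjacent-second u a a′ e

module Changes {X Y : Set} (f : X → Y) (_≟_ : DecidableEquality Y) where

  consIfChange : X → X → List (X × X) → List (X × X)
  consIfChange x y cs with f x ≟ f y
  ... | yes _ = cs
  ... | no _  = (x , y) ∷ cs

  changesFrom : X → List X → List (X × X)
  changesFrom x []      = []
  changesFrom x (y ∷ r) = consIfChange x y (changesFrom y r)

  changes : List X → List (X × X)
  changes []      = []
  changes (x ∷ r) = changesFrom x r

  NoTripleRun : List X → Set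
  NoTripleRun (x ∷ y ∷ z ∷ r) = ¬ (f x ≡ f y × f y ≡ f z) × NoTripleRun (y ∷ z ∷ r)
  NoTripleRun _ = ⊤

  changes-adjacent : ∀ {x y} l → (x , y) ∈ changes l → Adjacent x y l × f x ≢ f y
  changes-adjacent (x ∷ r) = from x r
    where
    from : ∀ {x′ y′} x r → (x′ , y′) ∈ changesFrom x r → Adjacent x′ y′ (x ∷ r) × f x′ ≢ f y′
    from x (y ∷ r) p with f x ≟ f y
    ... | yes _ = let a , d = from y r p in there a , d
    from x (y ∷ r) (here refl) | no fx≢fy = here , fx≢fy
    from x (y ∷ r) (there p)   | no _     = let a , d = from y r p in there a , d

  private
    noTripleRun-tail : ∀ x l → NoTripleRun (x ∷ l) → NoTripleRun l
    noTripleRun-tail x []          _  = _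
    noTripleRun-tail x (y ∷ [])    _  = _
    noTripleRun-tail x (y ∷ z ∷ r) nr = proj₂ nr

    two-more : ∀ n c → n ≤ 2 * c + 2 → 2 + n ≤ 2 * suc c + 2
    two-more n c n≤ = ≤-trans (+-monoʳ-≤ 2 n≤) (≤-reflexive (shift c))
      where
      shift : ∀ c → 2 + (2 * c + 2) ≡ 2 * suc c + 2
      shift = solve-∀

  changes-length : ∀ l → NoTripleRun l → length l ≤ 2 * length (changes l) + 2
  changes-length []      _  = z≤n
  changes-length (x ∷ r) nr = from x r nr
    where
    from : ∀ x r → NoTripleRun (x ∷ r) → suc (length r) ≤ 2 * length (changesFrom x r) + 2
    from x []      _  = s≤s z≤n
    from x (y ∷ r) nr with f x ≟ f y
    ... | no _ = ≤-trans (n≤1+n _) (two-more _ _ (from y r (noTripleRun-tail x (y ∷ r) nr)))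
    from x (y ∷ []) nr | yes _ = ≤-refl
    from x (y ∷ z ∷ r) (no-run , nr) | yes fx≡fy with f y ≟ f z
    ... | yes fy≡fz = ⊥-elim (no-run (fx≡fy , fy≡fz))
    ... | no _      = two-more _ _ (from z r (noTripleRun-tail y (z ∷ r) nr))

  changes-unique : ∀ {Z : Set} (g : X → Z) l → Unique (map g l) → Unique (changes l)
  changes-unique g []      _ = []
  changes-unique g (x ∷ r) u = from x r u
    where
    from : ∀ x r → Unique (map g (x ∷ r)) → Unique (changesFrom x r)
    from x []      _ = []
    from x (y ∷ r) (x∉ ∷ u′) with f x ≟ f y
    ... | yes _ = from y r u′
    ... | no _  = All.tabulate fresh ∷ from y r u′
      where
      fresh : ∀ {p} → p ∈ changesFrom y r → (x , y) ≢ p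
      fresh p∈ refl =
        All.lookup x∉ (∈-map⁺ g (adjacent-∈ˡ (proj₁ (changes-adjacent (y ∷ r) p∈)))) refl

-- 2xy ≤ x² + y², first for x ≤ y by writing y = x + d.
two-products-≤-ordered : ∀ {x y} → x ≤ y → 2 * x * y ≤ x * x + y * y
two-products-≤-ordered {x} {y} x≤y = subst (λ y → 2 * x * y ≤ x * x + y * y) (m+[n∸m]≡n x≤y)
  (≤-trans (m≤m+n _ _) (≤-reflexive (square-of-gap x (y ∸ x))))
  where
  square-of-gap : ∀ x d → 2 * x * (x + d) + d * d ≡ x * x + (x + d) * (x + d)
  square-of-gap = solve-∀

two-products-≤ : ∀ x y → 2 * x * y ≤ x * x + y * y
two-products-≤ x y with ≤-total x y
... | inj₁ x≤y = two-products-≤-ordered x≤y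
... | inj₂ y≤x = subst₂ _≤_ (swap y x) (+-comm (y * y) (x * x)) (two-products-≤-ordered y≤x)
  where
  swap : ∀ y x → 2 * y * x ≡ 2 * x * y
  swap = solve-∀

-- The inductive step of Cauchy–Schwarz: adding one class of size a to
-- N classes satisfying b² ≤ N·S.
cauchy-schwarz-step : ∀ N a b S → b * b ≤ N * S → (a + b) * (a + b) ≤ suc N * (a * a + S)
cauchy-schwarz-step zero a zero S _ = begin
  (a + 0) * (a + 0)  ≡⟨ cong₂ _*_ (+-identityʳ a) (+-identityʳ a) ⟩
  a * a              ≤⟨ m≤m+n (a * a) S ⟩
  a * a + S          ≡⟨ sym (*-identityˡ (a * a + S)) ⟩
  1 * (a * a + S)    ∎
  where open ≤-Reasoning
cauchy-schwarz-step (suc n) a b S b²≤NS = begin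
  (a + b) * (a + b)              ≡⟨ expand a b ⟩
  a * a + 2 * a * b + b * b      ≤⟨ +-mono-≤ (+-monoʳ-≤ (a * a) cross) b²≤NS ⟩
  a * a + (N * (a * a) + S) + N * S ≡⟨ collect N a S ⟩
  suc N * (a * a + S)            ∎
  where
  open ≤-Reasoning
  N : ℕ
  N = suc n
  -- N·2ab ≤ (Na)² + b² ≤ N(N a² + S); cancel N
  cross : 2 * a * b ≤ N * (a * a) + S
  cross = *-cancelˡ-≤ N (begin
    N * (2 * a * b)              ≡⟨ regroup N a b ⟩
    2 * (N * a) * b              ≤⟨ two-products-≤ (N * a) b ⟩
    N * a * (N * a) + b * b      ≤⟨ +-monoʳ-≤ (N * a * (N * a)) b²≤NS ⟩
    N * a * (N * a) + N * S      ≡⟨ factor N a S ⟩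
    N * (N * (a * a) + S)        ∎)
    where
    regroup : ∀ N a b → N * (2 * a * b) ≡ 2 * (N * a) * b
    regroup = solve-∀
    factor : ∀ N a S → N * a * (N * a) + N * S ≡ N * (N * (a * a) + S)
    factor = solve-∀
  expand : ∀ a b → (a + b) * (a + b) ≡ a * a + 2 * a * b + b * b
  expand = solve-∀
  collect : ∀ N a S → a * a + (N * (a * a) + S) + N * S ≡ suc N * (a * a + S)
  collect = solve-∀

module ClassCounting {X C : Set} (cls : X → C) (_≟_ : DecidableEquality C) where

  inClass outClass : C → List X → List X
  inClass  k = filter (λ x → cls x ≟ k)
  outClass k = filter (λ x → ¬? (cls x ≟ k))

  classPairCount : List X → List X → ℕ
  classPairCount l M = sum (map (λ x → length (inClass (cls x) M)) l)

  sameClassPairs : List X → List (X × X)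
  sameClassPairs l = filter (λ p → cls (proj₂ p) ≟ cls (proj₁ p)) (cartesianProduct l l)

  ∈-sameClassPairs : ∀ {x y l} → (x , y) ∈ sameClassPairs l → x ∈ l × y ∈ l × cls y ≡ cls x
  ∈-sameClassPairs {l = l} p∈ with ∈-filter⁻ (λ p → cls (proj₂ p) ≟ cls (proj₁ p)) p∈
  ... | p∈l×l , same with ∈-cartesianProduct⁻ l l p∈l×l
  ... | x∈l , y∈l = x∈l , y∈l , same

  sameClassPairs-unique : ∀ {l} → Unique l → Unique (sameClassPairs l)
  sameClassPairs-unique u = Unique.filter⁺ _ (Unique.cartesianProduct⁺ u u)

  length-sameClassPairs : ∀ l → length (sameClassPairs l) ≡ classPairCount l l
  length-sameClassPairs l = count-over l l
    where
    sameClass? : (p : X × X) → Dec (cls (proj₂ p) ≡ cls (proj₁ p))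
    sameClass? p = cls (proj₂ p) ≟ cls (proj₁ p)
    row : ∀ x M → length (filter sameClass? (map (x ,_) M)) ≡ length (inClass (cls x) M)
    row x []      = refl
    row x (y ∷ M) with cls y ≟ cls x
    ... | yes _ = cong suc (row x M)
    ... | no _  = row x M
    count-over : ∀ l M → length (filter sameClass? (cartesianProduct l M)) ≡ classPairCount l M
    count-over []      M = refl
    count-over (x ∷ l) M = begin
      length (filter sameClass? (map (x ,_) M ++ cartesianProduct l M))
        ≡⟨ cong length (filter-++ sameClass? (map (x ,_) M) (cartesianProduct l M)) ⟩
      length (filter sameClass? (map (x ,_) M) ++ filter sameClass? (cartesianProduct l M))
        ≡⟨ length-++ (filter sameClass? (map (x ,_) M)) ⟩
      length (filter sameClass? (map (x ,_) M)) + length (filter sameClass? (cartesianProduct l M))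
        ≡⟨ cong₂ _+_ (row x M) (count-over l M) ⟩
      classPairCount (x ∷ l) M ∎
      where open ≡-Reasoning

  private
    length-split : ∀ k l → length l ≡ length (inClass k l) + length (outClass k l)
    length-split k []      = refl
    length-split k (y ∷ l) with cls y ≟ k
    ... | yes _ = cong suc (length-split k l)
    ... | no _  = trans (cong suc (length-split k l)) (sym (+-suc _ _))

    count-split : ∀ k l M →
      classPairCount l M ≡ classPairCount (inClass k l) M + classPairCount (outClass k l) M
    count-split k []      M = refl
    count-split k (y ∷ l) M with cls y ≟ k
    ... | yes _ = trans (cong (row +_) (count-split k l M)) (sym (+-assoc row _ _))
      where
      row : ℕ
      row = length (inClass (cls y) M)
    ... | no _  = trans (cong (row +_) (count-split k l M)) (+-left-comm row (classPairCount (inClass k l) M) _)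
      where
      row : ℕ
      row = length (inClass (cls y) M)
      +-left-comm : ∀ a b c → a + (b + c) ≡ b + (a + c)
      +-left-comm = solve-∀

    count-inClass : ∀ k l M →
      classPairCount (inClass k l) M ≡ length (inClass k l) * length (inClass k M)
    count-inClass k []      M = refl
    count-inClass k (y ∷ l) M with cls y ≟ k
    ... | yes refl = cong (length (inClass (cls y) M) +_) (count-inClass k l M)
    ... | no _     = count-inClass k l M

    count-outClass-≤ : ∀ k r l → classPairCount r (outClass k l) ≤ classPairCount r l
    count-outClass-≤ k []      l = z≤n
    count-outClass-≤ k (x ∷ r) l = +-mono-≤ (row l) (count-outClass-≤ k r l)
      where
      row : ∀ l → length (inClass (cls x) (outClass k l)) ≤ length (inClass (cls x) l)
      row []      = z≤n
      row (y ∷ l) with cls y ≟ k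
      ... | yes _ with cls y ≟ cls x
      ...   | yes _ = m≤n⇒m≤1+n (row l)
      ...   | no _  = row l
      row (y ∷ l) | no _ with cls y ≟ cls x
      ...   | yes _ = s≤s (row l)
      ...   | no _  = row l

  cauchy-schwarz : ∀ classes l → (∀ {x} → x ∈ l → cls x ∈ classes) →
                   length l * length l ≤ length classes * classPairCount l l
  cauchy-schwarz []       []      _     = z≤n
  cauchy-schwarz []       (x ∷ l) cover with () ← cover (here refl)
  cauchy-schwarz (k ∷ ks) l       cover = begin
    length l * length l             ≡⟨ cong (λ n → n * n) (length-split k l) ⟩
    (a + b) * (a + b)               ≤⟨ cauchy-schwarz-step (length ks) a b S (cauchy-schwarz ks out cover-out) ⟩
    suc (length ks) * (a * a + S)   ≤⟨ *-monoʳ-≤ (suc (length ks)) in+out ⟩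
    suc (length ks) * classPairCount l l ∎
    where
    open ≤-Reasoning
    out : List X
    out = outClass k l
    a b S : ℕ
    a = length (inClass k l)
    b = length out
    S = classPairCount out out
    cover-out : ∀ {x} → x ∈ out → cls x ∈ ks
    cover-out x∈out with ∈-filter⁻ (λ x → ¬? (cls x ≟ k)) x∈out
    ... | x∈l , x∉k with cover x∈l
    ... | here x∈k  = ⊥-elim (x∉k x∈k)
    ... | there x∈ks = x∈ks
    in+out : a * a + S ≤ classPairCount l l
    in+out = begin
      a * a + S                              ≤⟨ +-monoʳ-≤ (a * a) (count-outClass-≤ k out l) ⟩
      a * a + classPairCount out l           ≡⟨ cong (_+ classPairCount out l) (count-inClass k l l) ⟨
      classPairCount (inClass k l) l + classPairCount out l ≡⟨ count-split k l l ⟨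
      classPairCount l l                     ∎

‾-involutive : ∀ x → ‾ (‾ x) ≡ x
‾-involutive (n , b) = cong (n ,_) (not-involutive b)

‾‾-expand : ∀ x → x ≡ ‾ (‾ x)
‾‾-expand x = sym (‾-involutive x)

‾-injective : ∀ {x y} → ‾ x ≡ ‾ y → x ≡ y
‾-injective {x} {y} e = trans (sym (‾-involutive x)) (trans (cong ‾_ e) (‾-involutive y))

Child : Site → Monomer → Site → Set
Child s t s′ = s′ ≡ leftSite s t ⊎ s′ ≡ rightSite s t

site-≡ : ∀ {a b c d a′ b′ c′ d′ : Sym} → a ≡ a′ → b ≡ b′ → c ≡ c′ → d ≡ d′ →
         ((a , b) , (c , d)) ≡ ((a′ , b′) , (c′ , d′))
site-≡ refl refl refl refl = refl

signOf : Monomer → Sign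
signOf = proj₁

same-sign-triple : ∀ {s t s′ t′ s″ t″} → Child s t s′ → Child s′ t′ s″ →
  CanInsert s t → CanInsert s′ t′ → CanInsert s″ t″ →
  signOf t ≡ signOf t′ → signOf t′ ≡ signOf t″ → s″ ≡ s′
same-sign-triple (inj₁ refl) (inj₁ refl) (ins⁺ refl) (ins⁺ refl) (ins⁺ refl) refl refl = refl
same-sign-triple (inj₁ refl) (inj₂ refl) (ins⁺ refl) (ins⁺ refl) (ins⁺ e) refl refl =
  site-≡ (‾-injective e) (‾-involutive _) refl refl
same-sign-triple (inj₂ refl) (inj₁ refl) (ins⁺ refl) (ins⁺ e′) (ins⁺ refl) refl refl =
  site-≡ refl refl (‾-involutive _) e′
same-sign-triple (inj₂ refl) (inj₂ refl) (ins⁺ refl) (ins⁺ e′) (ins⁺ e) refl refl =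
  site-≡ (‾-injective (trans e (sym e′))) refl refl refl
same-sign-triple (inj₁ refl) (inj₁ refl) (ins⁻ refl) (ins⁻ refl) (ins⁻ refl) refl refl = refl
same-sign-triple (inj₁ refl) (inj₂ refl) (ins⁻ refl) (ins⁻ refl) (ins⁻ e) refl refl =
  site-≡ (‾-involutive _) (‾-injective e) refl refl
same-sign-triple (inj₂ refl) (inj₁ refl) (ins⁻ refl) (ins⁻ e′) (ins⁻ refl) refl refl =
  site-≡ refl refl e′ (‾-involutive _)
same-sign-triple (inj₂ refl) (inj₂ refl) (ins⁻ refl) (ins⁻ e′) (ins⁻ e) refl refl =
  site-≡ refl (‾-injective (trans e (sym e′))) refl refl

data Side : Set where
  left right : Side

_≟Side_ : DecidableEquality Side
left  ≟Side left  = yes refl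
left  ≟Side right = no λ ()
right ≟Side left  = no λ ()
right ≟Side right = yes refl

end : Side → Site → End
end left  = proj₁
end right = proj₂

Key : Set
Key = Sign × Sym × Sym

-- The sites of a positive and a negative insertion sharing their end on side σ,
-- as a function of σ and of the insertion-set keys of the two monomer types.
pinnedSites : Side → Key × Key → Site × Site
pinnedSites left  ((_ , k₁ , k₂) , (_ , j₁ , j₂)) =
  ((‾ j₁ , ‾ k₁) , (‾ k₂ , j₁)) , ((‾ j₁ , ‾ k₁) , (k₁ , ‾ j₂))
pinnedSites right ((_ , k₁ , k₂) , (_ , j₁ , j₂)) =
  ((j₂ , ‾ k₁) , (‾ k₂ , ‾ j₂)) , ((‾ j₁ , k₂) , (‾ k₂ , ‾ j₂))

pinned : ∀ σ {P t M u} → CanInsert P t → CanInsert M u → signOf t ≡ plus → signOf u ≡ minus →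
         end σ P ≡ end σ M → (P , M) ≡ pinnedSites σ (insertionSetKey t , insertionSetKey u)
pinned left  (ins⁺ refl) (ins⁻ refl) refl refl refl =
  cong₂ _,_ (site-≡ (‾‾-expand _) (‾‾-expand _) (‾‾-expand _) refl)
            (site-≡ (‾‾-expand _) (‾‾-expand _) refl (‾‾-expand _))
pinned right (ins⁺ refl) (ins⁻ refl) refl refl refl =
  cong₂ _,_ (site-≡ (‾‾-expand _) (‾‾-expand _) (‾‾-expand _) (‾‾-expand _))
            (site-≡ (‾‾-expand _) (‾‾-expand _) (‾‾-expand _) (‾‾-expand _))

-- the ends a monomer (σ, x, y, z, w) brings into a polymer: (z , w) becomes
-- the left end of the right child, (x , y) the right end of the left child
newEnd : Side → Monomer → End
newEnd left  (_ , _ , _ , z , w) = (z , w)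
newEnd right (_ , x , y , _ , _) = (x , y)

child-end : ∀ σ {s t s′} → Child s t s′ → end σ s′ ≡ end σ s ⊎ end σ s′ ≡ newEnd σ t
child-end left  (inj₁ refl) = inj₁ refl
child-end left  (inj₂ refl) = inj₂ refl
child-end right (inj₁ refl) = inj₂ refl
child-end right (inj₂ refl) = inj₁ refl

_≟End_ : DecidableEquality End
_≟End_ = ≡-dec _≟S_ _≟S_

-- A created site keeps one end of its parent site; this is the side it keeps.
sharedSide : Site → Site → Side
sharedSide s s′ with end left s′ ≟End end left s
... | yes _ = left
... | no _  = right

shares-end : ∀ {s t s′} → Child s t s′ → end (sharedSide s s′) s′ ≡ end (sharedSide s s′) s
shares-end {s} {s′ = s′} _ with end left s′ ≟End end left s
... | yes same-left = same-left
shares-end (inj₁ refl) | no different-left = ⊥-elim (different-left refl)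
shares-end (inj₂ refl) | no _ = refl

Insertion : Set
Insertion = Site × Monomer

site : Insertion → Site
site = proj₁

type : Insertion → Monomer
type = proj₂

sign : Insertion → Sign
sign x = signOf (type x)

key : Insertion → Key
key x = insertionSetKey (type x)

Fits : Insertion → Set
Fits x = CanInsert (site x) (type x)

module _ {T : List Monomer} where

  chain-head : ∀ {x r} → Chain T (x ∷ r) → Fits x
  chain-head (single _ fits)     = fits
  chain-head (cons _ fits _ _)   = fits

  chain-adjacent : ∀ {xs x y} → Chain T xs → Adjacent x y xs →
                   Fits x × Fits y × Child (site x) (type x) (site y)
  chain-adjacent (cons _ fits child ch) here      = fits , chain-head ch , child
  chain-adjacent (cons _ _ _ ch)        (there a) = chain-adjacent ch a
  chain-adjacent (single _ _)           (there ())

  open Changes sign _≟Sign_ using (NoTripleRun)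

  chain-noTripleRun : ∀ {xs} → Chain T xs → Unique (map site xs) → NoTripleRun xs
  chain-noTripleRun (cons _ fits child ch@(cons _ fits′ child′ ch′)) (_ ∷ u@((y≢z ∷ _) ∷ _)) =
    (λ (e , e′) → y≢z (sym (same-sign-triple child child′ fits fits′ (chain-head ch′) e e′)))
    , chain-noTripleRun ch u
  chain-noTripleRun []                        _ = _
  chain-noTripleRun (single _ _)              _ = _
  chain-noTripleRun (cons _ _ _ (single _ _)) _ = _

  chain-ends : ∀ σ {x₀ r a} → Chain T (x₀ ∷ r) → a ∈ x₀ ∷ r →
    end σ (site a) ≡ end σ (site x₀) ⊎ ∃[ t ] (t ∈ map type (x₀ ∷ r) × end σ (site a) ≡ newEnd σ t)
  chain-ends σ _                   (here refl) = inj₁ refl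
  chain-ends σ (single _ _)        (there ())
  chain-ends σ (cons _ _ child ch) (there a∈) with chain-ends σ ch a∈
  ... | inj₂ (t , t∈ , e) = inj₂ (t , there t∈ , e)
  ... | inj₁ e with child-end σ child
  ...   | inj₁ e′ = inj₁ (trans e e′)
  ...   | inj₂ e′ = inj₂ (_ , here refl , trans e e′)

open Changes sign _≟Sign_ using (changes-adjacent; changes-length; changes-unique)
  renaming (changes to transitions)

Transition : Set
Transition = Insertion × Insertion

firstSign : Transition → Sign
firstSign τ = sign (proj₁ τ)

opposite : Sign → Sign
opposite plus  = minus
opposite minus = plus

entryBy : Sign → Transition → Insertion
entryBy plus  = proj₁
entryBy minus = proj₂

entryBy-both : ∀ o (P : Insertion → Set) {τ} → P (proj₁ τ) → P (proj₂ τ) → P (entryBy o τ)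
entryBy-both plus  _ p₁ p₂ = p₁
entryBy-both minus _ p₁ p₂ = p₂

plusEntry minusEntry : Transition → Insertion
plusEntry  τ = entryBy (firstSign τ) τ
minusEntry τ = entryBy (opposite (firstSign τ)) τ

plusEntry-sign : ∀ x y → sign x ≢ sign y → sign (plusEntry (x , y)) ≡ plus
plusEntry-sign (_ , plus  , _) _              _ = refl
plusEntry-sign (_ , minus , _) (_ , plus , _)  _ = refl
plusEntry-sign (_ , minus , _) (_ , minus , _) d = ⊥-elim (d refl)

minusEntry-sign : ∀ x y → sign x ≢ sign y → sign (minusEntry (x , y)) ≡ minus
minusEntry-sign (_ , minus , _) _              _ = refl
minusEntry-sign (_ , plus  , _) (_ , minus , _) _ = refl
minusEntry-sign (_ , plus  , _) (_ , plus , _)  d = ⊥-elim (d refl)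

Class : Set
Class = Side × End

classOf : Transition → Class
classOf (x , y) = sharedSide (site x) (site y) , end (sharedSide (site x) (site y)) (site x)

record Member (σ : Sign) (c : Class) (x : Insertion) : Set where
  field
    fits   : Fits x
    signed : sign x ≡ σ
    on-end : end (proj₁ c) (site x) ≡ proj₂ c

members-pinned : ∀ {c x y} → Member plus c x → Member minus c y →
  (site x , site y) ≡ pinnedSites (proj₁ c) (key x , key y)
members-pinned mx my =
  pinned _ (Member.fits mx) (Member.fits my) (Member.signed mx) (Member.signed my)
    (trans (Member.on-end mx) (sym (Member.on-end my)))

module _ {T xs} (ch : Chain T xs) where

  transition-members : ∀ {x y} → (x , y) ∈ transitions xs →
    Member plus (classOf (x , y)) (plusEntry (x , y)) × Member minus (classOf (x , y)) (minusEntry (x , y))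
  transition-members {x} {y} τ∈ = member (sign x) (plusEntry-sign x y signs-differ)
                                , member (opposite (sign x)) (minusEntry-sign x y signs-differ)
    where
    signs-differ : sign x ≢ sign y
    signs-differ = proj₂ (changes-adjacent xs τ∈)
    fits : Fits x × Fits y × Child (site x) (type x) (site y)
    fits = chain-adjacent ch (proj₁ (changes-adjacent xs τ∈))
    side : Side
    side = sharedSide (site x) (site y)
    member : ∀ o {σ} → sign (entryBy o (x , y)) ≡ σ → Member σ (classOf (x , y)) (entryBy o (x , y))
    member o signed = record
      { fits   = entryBy-both o Fits (proj₁ fits) (proj₁ (proj₂ fits))
      ; signed = signed
      ; on-end = entryBy-both o (λ z → end side (site z) ≡ end side (site x)) refl
                   (shares-end {t = type x} (proj₂ (proj₂ fits)))
      }

module _ {xs : List Insertion} (u : Unique (map site xs)) where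
  open AdjacentUnique site

  private
    adjacent-by : ∀ o {x y x′ y′} → Adjacent x y xs → Adjacent x′ y′ xs →
                  site (entryBy o (x , y)) ≡ site (entryBy o (x′ , y′)) → x ≡ x′ × y ≡ y′
    adjacent-by plus  = adjacent-first u
    adjacent-by minus = adjacent-second u

  entry-determines : ∀ o {τ υ} → τ ∈ transitions xs → υ ∈ transitions xs →
                     site (entryBy o τ) ≡ site (entryBy o υ) → τ ≡ υ
  entry-determines o τ∈ υ∈ same-site =
    let x≡x′ , y≡y′ = adjacent-by o (proj₁ (changes-adjacent xs τ∈)) (proj₁ (changes-adjacent xs υ∈))
                                    same-site
    in cong₂ _,_ x≡x′ y≡y′

  plusEntry-determines : ∀ {τ υ} → τ ∈ transitions xs → υ ∈ transitions xs → firstSign τ ≡ firstSign υ →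
                         site (plusEntry τ) ≡ site (plusEntry υ) → τ ≡ υ
  plusEntry-determines {τ} {υ} τ∈ υ∈ same-order same-site = entry-determines (firstSign τ) τ∈ υ∈
    (trans same-site (cong (λ o → site (entryBy o υ)) (sym same-order)))

  minusEntry-determines : ∀ {τ υ} → τ ∈ transitions xs → υ ∈ transitions xs → firstSign τ ≡ firstSign υ →
                          site (minusEntry τ) ≡ site (minusEntry υ) → τ ≡ υ
  minusEntry-determines {τ} {υ} τ∈ υ∈ same-order same-site = entry-determines (opposite (firstSign τ)) τ∈ υ∈
    (trans same-site (cong (λ o → site (entryBy (opposite o) υ)) (sym same-order)))

_≟Class_ : DecidableEquality Class
_≟Class_ = ≡-dec _≟Side_ _≟End_

open ClassCounting classOf _≟Class_

Code : Set
Code = Side × (Sign × Sign) × (Key × Key)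

code : Transition × Transition → Code
code (τ , τ′) = proj₁ (classOf τ) , (firstSign τ , firstSign τ′) , (key (plusEntry τ) , key (minusEntry τ′))

module _ {T xs} (ch : Chain T xs) (u : Unique (map site xs)) where

  pair-sites : ∀ {τ τ′} → (τ , τ′) ∈ sameClassPairs (transitions xs) →
    (site (plusEntry τ) , site (minusEntry τ′))
      ≡ pinnedSites (proj₁ (classOf τ)) (key (plusEntry τ) , key (minusEntry τ′))
  pair-sites {τ} {τ′} p∈ with ∈-sameClassPairs p∈
  ... | τ∈ , τ′∈ , same-class =
    members-pinned (proj₁ (transition-members ch τ∈))
                   (subst (λ c → Member minus c (minusEntry τ′)) same-class (proj₂ (transition-members ch τ′∈)))

  code-injective : ∀ {p q} → p ∈ sameClassPairs (transitions xs) → q ∈ sameClassPairs (transitions xs) →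
                   code p ≡ code q → p ≡ q
  code-injective {τ , τ′} {υ , υ′} p∈ q∈ same-code with ∈-sameClassPairs p∈ | ∈-sameClassPairs q∈
  ... | τ∈ , τ′∈ , _ | υ∈ , υ′∈ , _ =
    cong₂ _,_ (plusEntry-determines u τ∈ υ∈ (cong proj₁ same-orders) (cong proj₁ same-sites))
              (minusEntry-determines u τ′∈ υ′∈ (cong proj₂ same-orders) (cong proj₂ same-sites))
    where
    same-orders : (firstSign τ , firstSign τ′) ≡ (firstSign υ , firstSign υ′)
    same-orders = cong (λ c → proj₁ (proj₂ c)) same-code
    same-sites : (site (plusEntry τ) , site (minusEntry τ′)) ≡ (site (plusEntry υ) , site (minusEntry υ′))
    same-sites = begin
      (site (plusEntry τ) , site (minusEntry τ′))
        ≡⟨ pair-sites p∈ ⟩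
      pinnedSites (proj₁ (classOf τ)) (key (plusEntry τ) , key (minusEntry τ′))
        ≡⟨ cong₂ pinnedSites (cong proj₁ same-code) (cong (λ c → proj₂ (proj₂ c)) same-code) ⟩
      pinnedSites (proj₁ (classOf υ)) (key (plusEntry υ) , key (minusEntry υ′))
        ≡⟨ pair-sites q∈ ⟨
      (site (plusEntry υ) , site (minusEntry υ′)) ∎
      where open ≡-Reasoning

signs : List Sign
signs = plus ∷ minus ∷ []

sides : List Side
sides = left ∷ right ∷ []

sign∈signs : ∀ σ → σ ∈ signs
sign∈signs plus  = here refl
sign∈signs minus = there (here refl)

side∈sides : ∀ σ → σ ∈ sides
side∈sides left  = here refl
side∈sides right = there (here refl)

setKeys : List Insertion → List Key
setKeys xs = deduplicate _≟K_ (map (λ p → insertionSetKey (proj₂ p)) xs)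

typesOf : List Insertion → List Monomer
typesOf xs = deduplicate _≟M_ (map proj₂ xs)

codes : List Insertion → List Code
codes xs = cartesianProduct sides (cartesianProduct (cartesianProduct signs signs)
                                                    (cartesianProduct (setKeys xs) (setKeys xs)))

length-codes : ∀ xs → length (codes xs) ≡ 8 * (numSets xs * numSets xs)
length-codes xs = begin
  length (codes xs)
    ≡⟨ length-cartesianProduct sides (cartesianProduct orders keyPairs) ⟩
  2 * length (cartesianProduct orders keyPairs)
    ≡⟨ cong (2 *_) (length-cartesianProduct orders keyPairs) ⟩
  2 * (length orders * length keyPairs)
    ≡⟨ cong (2 *_) (cong₂ _*_ (length-cartesianProduct signs signs) (length-cartesianProduct keys keys)) ⟩
  2 * (4 * (m * m))
    ≡⟨ *-assoc 2 4 (m * m) ⟨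
  8 * (m * m) ∎
  where
  open ≡-Reasoning
  keys : List Key
  keys = setKeys xs
  m : ℕ
  m = numSets xs
  orders : List (Sign × Sign)
  orders = cartesianProduct signs signs
  keyPairs : List (Key × Key)
  keyPairs = cartesianProduct keys keys

transition-entries-∈ : ∀ {xs x y} → (x , y) ∈ transitions xs → x ∈ xs × y ∈ xs
transition-entries-∈ {z ∷ _} τ∈ =
  let adjacent = proj₁ (changes-adjacent (z ∷ _) τ∈) in adjacent-∈ˡ adjacent , there (adjacent-∈ʳ adjacent)

code-∈-codes : ∀ {xs p} → p ∈ sameClassPairs (transitions xs) → code p ∈ codes xs
code-∈-codes {xs} {τ , τ′} p∈ =
  ∈-cartesianProduct⁺ (side∈sides _) (∈-cartesianProduct⁺
    (∈-cartesianProduct⁺ (sign∈signs _) (sign∈signs _))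
    (∈-cartesianProduct⁺ (key-∈ (entry-∈ (firstSign τ) τ∈)) (key-∈ (entry-∈ (opposite (firstSign τ′)) τ′∈))))
  where
  τ∈ : τ ∈ transitions xs
  τ∈ = proj₁ (∈-sameClassPairs p∈)
  τ′∈ : τ′ ∈ transitions xs
  τ′∈ = proj₁ (proj₂ (∈-sameClassPairs p∈))
  entry-∈ : ∀ o {υ} → υ ∈ transitions xs → entryBy o υ ∈ xs
  entry-∈ o υ∈ = entryBy-both o (_∈ xs) (proj₁ (transition-entries-∈ υ∈)) (proj₂ (transition-entries-∈ υ∈))
  key-∈ : ∀ {x} → x ∈ xs → key x ∈ setKeys xs
  key-∈ x∈ = ∈-deduplicate⁺ _≟K_ (∈-map⁺ (λ p → insertionSetKey (proj₂ p)) x∈)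

initialClasses : Insertion → List Class
initialClasses x₀ = map (λ σ → σ , end σ (site x₀)) sides

broughtClasses : List Monomer → List Class
broughtClasses ts = cartesianProductWith (λ σ t → σ , newEnd σ t) sides ts

classes : Insertion → List Monomer → List Class
classes x₀ ts = initialClasses x₀ ++ broughtClasses ts

length-classes : ∀ x₀ ts → length (classes x₀ ts) ≡ 2 + 2 * length ts
length-classes x₀ ts =
  trans (length-++ (initialClasses x₀) {broughtClasses ts})
        (cong₂ _+_ (length-map (λ σ → σ , end σ (site x₀)) sides)
                   (length-cartesianProductWith (λ σ t → σ , newEnd σ t) sides ts))

classOf-∈-classes : ∀ {T x₀ r τ} → Chain T (x₀ ∷ r) → τ ∈ transitions (x₀ ∷ r) →
                    classOf τ ∈ classes x₀ (typesOf (x₀ ∷ r))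
classOf-∈-classes {x₀ = x₀} {r} {x , y} ch τ∈ =
  end-listed (chain-ends σ ch (proj₁ (transition-entries-∈ τ∈)))
  where
  σ : Side
  σ = sharedSide (site x) (site y)
  end-listed : end σ (site x) ≡ end σ (site x₀) ⊎ ∃[ t ] (t ∈ map type (x₀ ∷ r) × end σ (site x) ≡ newEnd σ t) →
               (σ , end σ (site x)) ∈ classes x₀ (typesOf (x₀ ∷ r))
  end-listed (inj₁ e) rewrite e = ∈-++⁺ˡ (∈-map⁺ (λ σ → σ , end σ (site x₀)) (side∈sides σ))
  end-listed (inj₂ (t , t∈ , e)) rewrite e =
    ∈-++⁺ʳ (initialClasses x₀)
      (∈-cartesianProductWith⁺ (λ σ t → σ , newEnd σ t) (side∈sides σ) (∈-deduplicate⁺ _≟M_ t∈))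

-- d² ≤ (2 + 2k)·S and S ≤ 8m² give d² ≤ 32·m²·k, since 2 + 2k ≤ 4k for k ≥ 1.
transitions-estimate : ∀ {d k m S} → 1 ≤ k → d * d ≤ (2 + 2 * k) * S → S ≤ 8 * (m * m) →
                       d * d ≤ 32 * (m * m * k)
transitions-estimate {d} {k} {m} {S} k≥1 d²≤ S≤ = begin
  d * d                            ≤⟨ d²≤ ⟩
  (2 + 2 * k) * S                  ≤⟨ *-mono-≤ (+-monoˡ-≤ (2 * k) (*-monoʳ-≤ 2 k≥1)) S≤ ⟩
  (2 * k + 2 * k) * (8 * (m * m))  ≡⟨ regroup k m ⟩
  32 * (m * m * k)                 ∎
  where
  open ≤-Reasoning
  regroup : ∀ k m → (2 * k + 2 * k) * (8 * (m * m)) ≡ 32 * (m * m * k)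
  regroup = solve-∀

-- n ≤ 2d + 2 and d² ≤ 32Q with Q ≥ 1 give n² ≤ 512Q:
-- for d = 0 since n ≤ 2, otherwise since n ≤ 4d.
length-estimate : ∀ {n Q} d → 1 ≤ Q → n ≤ 2 * d + 2 → d * d ≤ 32 * Q → n * n ≤ 512 * Q
length-estimate {n} {Q} zero Q≥1 n≤2 _ = begin
  n * n     ≤⟨ *-mono-≤ n≤2 n≤2 ⟩
  4 * 1     ≤⟨ *-mono-≤ (m≤m+n 4 508) Q≥1 ⟩
  512 * Q   ∎
  where open ≤-Reasoning
length-estimate {n} {Q} d@(suc _) _ n≤2d+2 d²≤32Q = begin
  n * n                ≤⟨ *-mono-≤ n≤4d n≤4d ⟩
  (4 * d) * (4 * d)    ≡⟨ sixteen d ⟩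
  16 * (d * d)         ≤⟨ *-monoʳ-≤ 16 d²≤32Q ⟩
  16 * (32 * Q)        ≡⟨ *-assoc 16 32 Q ⟨
  512 * Q              ∎
  where
  open ≤-Reasoning
  sixteen : ∀ d → (4 * d) * (4 * d) ≡ 16 * (d * d)
  sixteen = solve-∀
  double : ∀ d → 2 * d + 2 * d ≡ 4 * d
  double = solve-∀
  n≤4d : n ≤ 4 * d
  n≤4d = begin
    n              ≤⟨ n≤2d+2 ⟩
    2 * d + 2      ≤⟨ +-monoʳ-≤ (2 * d) (*-monoʳ-≤ 2 (s≤s z≤n)) ⟩
    2 * d + 2 * d  ≡⟨ double d ⟩
    4 * d          ∎

final-estimate : ∀ {n d k m S} → 1 ≤ k → 1 ≤ m → n ≤ 2 * d + 2 →
                 d * d ≤ (2 + 2 * k) * S → S ≤ 8 * (m * m) → n ^ 2 ≤ 512 * (m ^ 2 * k)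
final-estimate {n} {d} {k} {m} k≥1 m≥1 n≤2d+2 d²≤ S≤ =
  subst₂ _≤_ (sym (square n)) (cong (λ m² → 512 * (m² * k)) (sym (square m)))
    (length-estimate d (*-mono-≤ (*-mono-≤ m≥1 m≥1) k≥1) n≤2d+2 (transitions-estimate {d} {k} {m} k≥1 d²≤ S≤))
  where
  square : ∀ x → x ^ 2 ≡ x * x
  square x = cong (x *_) (*-identityʳ x)

lemma4 : ∃[ C ] ((S : InsertionSystem) (xs : List (Site × Monomer)) →
           InsertionSequence S xs → Unique (map proj₁ xs) →
           length xs ^ 2 ≤ C * (numSets xs ^ 2 * numTypes xs))
lemma4 = 512 , bound
  where
  bound : (S : InsertionSystem) (xs : List Insertion) → InsertionSequence S xs → Unique (map site xs) →
          length xs ^ 2 ≤ 512 * (numSets xs ^ 2 * numTypes xs)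
  bound _ []           _        _ = z≤n
  bound _ xs@(x₀ ∷ r) (ch , _) u =
    final-estimate {length xs} {length ts} {numTypes xs} {numSets xs} {classPairCount ts ts}
      (s≤s z≤n) (s≤s z≤n)
      -- signs change at least every second step
      (changes-length xs (chain-noTripleRun ch u))
      -- Cauchy–Schwarz over the 2 + 2k classes
      (subst (λ c → length ts * length ts ≤ c * classPairCount ts ts) (length-classes x₀ (typesOf xs))
        (cauchy-schwarz (classes x₀ (typesOf xs)) ts (classOf-∈-classes ch)))
      -- same-class pairs are coded injectively by the 8m² codes
      (subst₂ _≤_ (length-sameClassPairs ts) (length-codes xs)
        (injection-length {ys = codes xs} code (sameClassPairs-unique (changes-unique site xs u))
          (code-injective ch u) (code-∈-codes {xs})))
    where
    ts : List Transition
    ts = transitions xs
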